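{- Let $m\ge 3$ and $n\ge 2$. For every positive integer $k$, $$\chi_{B_1^*(m,n)}(2k+1)=\Big[\sum_{i=0}^{m-3}(-1)^i(2k)^{(m-2)-i}\Big]\,\chi_{B_1^*(m,n-1)}(2k+1)+(-1)^{m-2}\chi_{B_m^{n-1}}(2k+1).$$
   Context: A signed graph $(G,\sigma)$ is a finite graph $G$ (parallel edges allowed) with a sign function $\sigma:E(G)\to\{+1,-1\}$; its signature is the set of negative edges. A signed coloring in $2k+1$ colors is a map $c:V(G)\to\{ -k,\dots,k\}$; it is proper if $c(y)\neq\sigma(e)c(x)$ for every edge $e=xy$. The signed chromatic polynomial $\chi_{(G,\sigma)}(2k+1)$ is the number of proper signed colorings in $2k+1$ colors. For integers $m\ge 3$, $n\ge 1$, the Book graph $B(m,n)$ has vertex set $\{u,v\}\cup\{u_j^l:1\le l\le n,\,1\le j\le m-2\}$ and consists of the $n$ cycles $u\,u_1^l\cdots u_{m-2}^l\,v\,u$ sharing the edge $uv$. For $1\le l\le n$, $B_l^*(m,n)$ denotes $B(m,n)$ with signature $\{uv,uu_1^1,\dots,uu_1^{l-1}\}$; in particular $B_1^*(m,n)$ has signature $\{uv\}$. The signed graph $B_m^n$ is obtained from $B(m,n)$ with all edges positive by replacing the edge $uv$ with two parallel edges between $u$ and $v$, one positive and one negative. -}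

module Defs where

open import Data.Nat as ℕ using (ℕ; zero; suc; _∸_)
open import Data.Integer as ℤ using (ℤ; +_; -_; _-_)
open import Data.Fin as Fin using (Fin; zero; suc; toℕ; _↑ʳ_; combine; inject₁; fromℕ)
open import Data.Vec as Vec using (Vec; []; _∷_; lookup)
open import Data.List as List using (List; []; _∷_; _++_; map; concatMap; allFin; filter; length; upTo; foldr)
open import Data.List.Relation.Unary.All as All using (All)
open import Data.Product using (_×_; _,_)
open import Relation.Binary.PropositionalEquality using (_≡_; _≢_)
open import Relation.Nullary using (Dec; ¬?)
open import Relation.Unary using (Decidable)

data Sign : Set where
  pos neg : Sign

act : Sign → ℤ → ℤ
act pos c = c
act neg c = - c

-- A finite signed graph (parallel edges allowed): vertex set Fin V,
-- edge list (multiset) of triples (x , y , σ(e)).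
record SignedGraph : Set where
  constructor mkSG
  field
    V : ℕ
    E : List (Fin V × Fin V × Sign)
open SignedGraph public

-- A signed colouring in 2k+1 colours, encoded as a vector of Fin (2k+1);
-- entry i denotes the colour toℕ i - k ∈ {-k,...,k} (a bijection).
Coloring : ℕ → ℕ → Set
Coloring k V = Vec (Fin (suc (2 ℕ.* k))) V

colourValue : (k : ℕ) → Fin (suc (2 ℕ.* k)) → ℤ
colourValue k i = + toℕ i - + k

col : ∀ k {V} → Coloring k V → Fin V → ℤ
col k c x = colourValue k (lookup c x)

EdgeOK : ∀ k {V} → Coloring k V → Fin V × Fin V × Sign → Set
EdgeOK k c (x , y , s) = col k c y ≢ act s (col k c x)

Proper : ∀ k (G : SignedGraph) → Coloring k (V G) → Set
Proper k G c = All (EdgeOK k c) (E G)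

Proper? : ∀ k (G : SignedGraph) → Decidable (Proper k G)
Proper? k G c = All.all? (λ { (x , y , s) → ¬? (col k c y ℤ.≟ act s (col k c x)) }) (E G)

allVecs : (q V : ℕ) → List (Vec (Fin q) V)
allVecs q zero = [] ∷ []
allVecs q (suc V) = concatMap (λ i → map (i ∷_) (allVecs q V)) (allFin q)

-- signed chromatic polynomial evaluated at 2k+1: number of proper signed colourings
χ : SignedGraph → ℕ → ℕ
χ G k = length (filter (Proper? k G) (allVecs (suc (2 ℕ.* k)) (V G)))

-- Vertices of B(m,n): Fin (2 + n * (m-2)),
-- u = 0, v = 1, u_{j+1}^{l+1} = 2 ↑ʳ combine l j  (l : Fin n, j : Fin (m-2)).
-- The path length m-2 is written suc (m ∸ 3), which equals m-2 for m ≥ 3.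

BookV : ℕ → ℕ → ℕ
BookV m n = 2 ℕ.+ n ℕ.* suc (m ∸ 3)

bu bv : ∀ m n → Fin (BookV m n)
bu m n = zero
bv m n = suc zero

inner : ∀ m n → Fin n → Fin (suc (m ∸ 3)) → Fin (BookV m n)
inner m n l j = 2 ↑ʳ combine l j

-- the edges of the l-th cycle other than uv:
-- u u_1^l, u_1^l u_2^l, ..., u_{m-3}^l u_{m-2}^l, u_{m-2}^l v
pageEdges : ∀ m n → Fin n → List (Fin (BookV m n) × Fin (BookV m n))
pageEdges m n l =
  (bu m n , inner m n l zero)
  ∷ (map (λ j → (inner m n l (inject₁ j) , inner m n l (suc j))) (allFin (m ∸ 3))
     ++ ((inner m n l (fromℕ (m ∸ 3)) , bv m n) ∷ []))

allPageEdges : ∀ m n → List (Fin (BookV m n) × Fin (BookV m n))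
allPageEdges m n = concatMap (pageEdges m n) (allFin n)

positive : ∀ {A B : Set} → A × B → A × B × Sign
positive (x , y) = (x , y , pos)

B1* : ℕ → ℕ → SignedGraph
B1* m n = mkSG (BookV m n) ((bu m n , bv m n , neg) ∷ map positive (allPageEdges m n))

Bmn : ℕ → ℕ → SignedGraph
Bmn m n = mkSG (BookV m n) ((bu m n , bv m n , pos) ∷ (bu m n , bv m n , neg) ∷ map positive (allPageEdges m n))

coeffSum : ℕ → ℕ → ℤ
coeffSum m k = foldr ℤ._+_ (+ 0)
  (map (λ i → ((- + 1) ℤ.^ i) ℤ.* ((+ (2 ℕ.* k)) ℤ.^ ((m ∸ 2) ∸ i))) (upTo (m ∸ 2)))

-- A page recurrence for the signed chromatic polynomial of Book graphs:
--   χ_{B₁*(m,n)} = c_m · χ_{B₁*(m,n-1)} + (-1)^{m-2} · χ_{B_m^{n-1}}.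
-- The argument needs only m ≥ 3 and n ≥ 1 (any k ≥ 0).
--
-- Write χ_G(2k+1) as a sum over all colourings of the product of
-- edge weights, an edge weighing 1 if it is properly coloured and 0 otherwise.
-- Fix the colours a, b of the spine vertices u, v.  The first page of
-- B₁*(m,n) is a path u – x₁ – … – x_{m-2} – v whose inner vertices occur in no
-- other edge, so the weight factors as (path weight) · (weight of B₁*(m,n-1)).
-- Summing the path weight over the inner colours counts walks of length m-1
-- from a to b in the complete graph on the 2k+1 colours, which equals
--   c_m + (-1)^{m-2} · [a ≠ b],   c_m = Σ_{i<m-2} (-1)^i (2k)^{m-2-i}.
-- The term c_m yields c_m · χ_{B₁*(m,n-1)}; the term [a ≠ b] is exactly the
-- weight of the extra positive edge uv of B_m^{n-1}.

module Submission where

open import Defs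
open import Algebra.Bundles using (Monoid)
open import Data.Bool using (Bool; true; false; not)
open import Data.Nat as ℕ using (ℕ; zero; suc; _∸_; _≤_; s≤s)
import Data.Nat.Properties as ℕP
open import Data.Integer as ℤ using (ℤ; +_; -_; _+_; _*_; _^_; _-_)
import Data.Integer.Properties as ℤP
open import Data.Integer.Tactic.RingSolver using (solve-∀)
open import Data.Fin as Fin using (Fin; zero; suc; toℕ; _↑ʳ_; inject₁; fromℕ)
import Data.Fin.Properties as FinP
open import Data.Vec as Vec using (Vec; []; _∷_; lookup)
import Data.Vec.Properties as VecP
open import Data.List as List using (List; []; _∷_; _++_; map; concat; concatMap; allFin; filter; length; foldr; applyUpTo)
import Data.List.Properties as ListP
open import Data.List.Relation.Unary.All as All using ()
open import Data.Product using (_×_; _,_)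
open import Function using (_∘_)
open import Relation.Binary.PropositionalEquality
open import Relation.Binary.Definitions using (DecidableEquality)
open import Relation.Nullary using (Dec; yes; no; does; ¬?)
open import Relation.Nullary.Decidable using (dec-true; dec-false)
open import Relation.Unary using (Pred; Decidable)
open import Algebra.Properties.Semiring.Sum ℤP.+-*-semiring
  using (sum; sum-syntax; sum-cong-≗; ∑-distrib-+; *-distribˡ-sum; sum-replicate-zero; sum-init-last)

open ≡-Reasoning

𝟙 : Bool → ℤ
𝟙 true = + 1
𝟙 false = + 0

indicator : ∀ {p} {P : Set p} → Dec P → ℤ
indicator d = 𝟙 (does d)

does-≟-sym : ∀ {a} {A : Set a} (_≟_ : DecidableEquality A) x y → does (x ≟ y) ≡ does (y ≟ x)
does-≟-sym _≟_ x y with x ≟ y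
... | yes x≡y = sym (dec-true (y ≟ x) (sym x≡y))
... | no x≢y = sym (dec-false (y ≟ x) (x≢y ∘ sym))

module ListFold {c ℓ} (M : Monoid c ℓ) where
  open Monoid M using (Carrier; _≈_; _∙_; ε; ∙-congˡ; assoc; identityˡ)
    renaming (sym to ≈-sym; trans to ≈-trans)

  foldMap : ∀ {a} {A : Set a} → (A → Carrier) → List A → Carrier
  foldMap f [] = ε
  foldMap f (x ∷ xs) = f x ∙ foldMap f xs

  foldMap-++ : ∀ {a} {A : Set a} (f : A → Carrier) xs ys →
    foldMap f (xs ++ ys) ≈ foldMap f xs ∙ foldMap f ys
  foldMap-++ f [] ys = ≈-sym (identityˡ _)
  foldMap-++ f (x ∷ xs) ys = ≈-trans (∙-congˡ (foldMap-++ f xs ys)) (≈-sym (assoc _ _ _))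

  foldMap-map : ∀ {a b} {A : Set a} {B : Set b} (f : B → Carrier) (g : A → B) xs →
    foldMap f (map g xs) ≡ foldMap (f ∘ g) xs
  foldMap-map f g [] = refl
  foldMap-map f g (x ∷ xs) = cong (f (g x) ∙_) (foldMap-map f g xs)

  foldMap-cong : ∀ {a} {A : Set a} {f g : A → Carrier} → (∀ x → f x ≡ g x) → ∀ xs →
    foldMap f xs ≡ foldMap g xs
  foldMap-cong e [] = refl
  foldMap-cong e (x ∷ xs) = cong₂ _∙_ (e x) (foldMap-cong e xs)

open ListFold ℤP.+-0-monoid using ()
  renaming (foldMap to Σₗ; foldMap-++ to Σₗ-++; foldMap-map to Σₗ-map)
open ListFold ℤP.*-1-monoid using ()
  renaming (foldMap to ∏ₗ; foldMap-++ to ∏ₗ-++; foldMap-map to ∏ₗ-map; foldMap-cong to ∏ₗ-cong)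

count-filter : ∀ {a p} {A : Set a} {P : Pred A p} (P? : Decidable P) xs →
  + length (filter P? xs) ≡ Σₗ (indicator ∘ P?) xs
count-filter P? [] = refl
count-filter P? (x ∷ xs) with does (P? x)
... | true = trans (ℤP.pos-+ 1 _) (cong (_+_ (+ 1)) (count-filter P? xs))
... | false = trans (count-filter P? xs) (sym (ℤP.+-identityˡ _))

indicator-all : ∀ {a p} {A : Set a} {P : Pred A p} (P? : Decidable P) xs →
  indicator (All.all? P? xs) ≡ ∏ₗ (indicator ∘ P?) xs
indicator-all P? [] = refl
indicator-all P? (x ∷ xs) with does (P? x)
... | true = trans (indicator-all P? xs) (sym (ℤP.*-identityˡ _))
... | false = refl

Σₗ-concatMap : ∀ {a b} {A : Set a} {B : Set b} (f : B → ℤ) (g : A → List B) {n} (h : Fin n → A) →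
  Σₗ f (concatMap g (List.tabulate h)) ≡ ∑[ i < n ] Σₗ f (g (h i))
Σₗ-concatMap f g {zero} h = refl
Σₗ-concatMap f g {suc n} h =
  trans (Σₗ-++ f (g (h zero)) _) (cong (_+_ (Σₗ f (g (h zero)))) (Σₗ-concatMap f g (h ∘ suc)))

∑-linear : ∀ {n} x y (f g : Fin n → ℤ) →
  ∑[ i < n ] (x * f i + y * g i) ≡ x * sum f + y * sum g
∑-linear x y f g = trans (∑-distrib-+ (λ i → x * f i) (λ i → y * g i))
  (sym (cong₂ _+_ (*-distribˡ-sum x f) (*-distribˡ-sum y g)))

sum-ones : ∀ n → ∑[ i < n ] (+ 1) ≡ + n
sum-ones zero = refl
sum-ones (suc n) = trans (cong (_+_ (+ 1)) (sum-ones n)) (sym (ℤP.pos-+ 1 n))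

sum-applyUpTo : ∀ (f : ℕ → ℤ) (h : ℕ → ℕ) n →
  foldr _+_ (+ 0) (map f (applyUpTo h n)) ≡ ∑[ i < n ] f (h (toℕ i))
sum-applyUpTo f h zero = refl
sum-applyUpTo f h (suc n) = cong (_+_ (f (h 0))) (sum-applyUpTo f (h ∘ suc) n)

module Colourings (k : ℕ) where

  -- The 2k+1 colours, and t = 2k, the number of colours different from a given one.
  q : ℕ
  q = suc (2 ℕ.* k)

  Colour : Set
  Colour = Fin q

  t : ℤ
  t = + (2 ℕ.* k)

  ∑col : ∀ V → (Coloring k V → ℤ) → ℤ
  ∑col zero f = f []
  ∑col (suc V) f = ∑[ i < q ] ∑col V (λ cs → f (i ∷ cs))

  ∑col-cong : ∀ V {f g : Coloring k V → ℤ} → (∀ c → f c ≡ g c) → ∑col V f ≡ ∑col V g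
  ∑col-cong zero e = e []
  ∑col-cong (suc V) e = sum-cong-≗ (λ i → ∑col-cong V (e ∘ (i ∷_)))

  ∑col-++ : ∀ p r (f : Coloring k (p ℕ.+ r) → ℤ) →
    ∑col (p ℕ.+ r) f ≡ ∑col p (λ xs → ∑col r (λ ys → f (xs Vec.++ ys)))
  ∑col-++ zero r f = refl
  ∑col-++ (suc p) r f = sum-cong-≗ (λ i → ∑col-++ p r (f ∘ (i ∷_)))

  ∑col-*ˡ : ∀ V x (f : Coloring k V → ℤ) → ∑col V (λ c → x * f c) ≡ x * ∑col V f
  ∑col-*ˡ zero x f = refl
  ∑col-*ˡ (suc V) x f =
    trans (sum-cong-≗ (λ i → ∑col-*ˡ V x (f ∘ (i ∷_))))
      (sym (*-distribˡ-sum x (λ i → ∑col V (λ cs → f (i ∷ cs)))))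

  ∑col-*ʳ : ∀ V x (f : Coloring k V → ℤ) → ∑col V (λ c → f c * x) ≡ ∑col V f * x
  ∑col-*ʳ V x f = trans (∑col-cong V (λ c → ℤP.*-comm (f c) x))
    (trans (∑col-*ˡ V x f) (ℤP.*-comm x (∑col V f)))

  Σₗ-allVecs : ∀ V (f : Coloring k V → ℤ) → Σₗ f (allVecs q V) ≡ ∑col V f
  Σₗ-allVecs zero f = ℤP.+-identityʳ (f [])
  Σₗ-allVecs (suc V) f = trans (Σₗ-concatMap f (λ i → map (i ∷_) (allVecs q V)) (λ i → i))
    (sum-cong-≗ (λ i → trans (Σₗ-map f (i ∷_) (allVecs q V)) (Σₗ-allVecs V (f ∘ (i ∷_)))))

  colourValue-injective : ∀ {i j : Colour} → colourValue k i ≡ colourValue k j → i ≡ j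
  colourValue-injective {i} {j} e = FinP.toℕ-injective (ℤP.+-injective (begin
      + toℕ i                  ≡⟨ shift (+ toℕ i) (+ k) ⟩
      colourValue k i + + k    ≡⟨ cong (_+ + k) e ⟩
      colourValue k j + + k    ≡⟨ shift (+ toℕ j) (+ k) ⟨
      + toℕ j                  ∎))
    where
    shift : ∀ x y → x ≡ x - y + y
    shift = solve-∀

  compatible : Sign → Colour → Colour → ℤ
  compatible s i j = indicator (¬? (colourValue k j ℤ.≟ act s (colourValue k i)))

  edgeWeight : ∀ {V} → Coloring k V → Fin V × Fin V × Sign → ℤ
  edgeWeight c (x , y , s) = compatible s (lookup c x) (lookup c y)

  χ-as-sum : ∀ G → + χ G k ≡ ∑col (V G) (λ c → ∏ₗ (edgeWeight c) (E G))
  χ-as-sum G = trans (count-filter (Proper? k G) (allVecs q (V G)))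
    (trans (Σₗ-allVecs (V G) _) (∑col-cong (V G) (λ c → indicator-all _ (E G))))

  ne : Colour → Colour → ℤ
  ne = compatible pos

  δ : ∀ {n} → Fin n → Fin n → ℤ
  δ i j = indicator (i FinP.≟ j)

  ne≡1-δ : ∀ i j → ne i j ≡ + 1 - δ i j
  ne≡1-δ i j with i FinP.≟ j
  ... | yes refl = cong (𝟙 ∘ not) (dec-true (colourValue k i ℤ.≟ colourValue k i) refl)
  ... | no i≢j = cong (𝟙 ∘ not)
    (dec-false (colourValue k j ℤ.≟ colourValue k i) (i≢j ∘ sym ∘ colourValue-injective))

  ne-sym : ∀ i j → ne i j ≡ ne j i
  ne-sym i j = cong (𝟙 ∘ not) (does-≟-sym ℤ._≟_ (colourValue k j) (colourValue k i))

  delta-sum : ∀ {n} (a : Fin n) (f : Fin n → ℤ) → ∑[ x < n ] (δ a x * f x) ≡ f a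
  delta-sum {suc n} zero f = begin
      + 1 * f zero + ∑[ x < n ] (+ 0 * f (suc x))   ≡⟨ cong (_+_ (+ 1 * f zero)) (sum-replicate-zero n) ⟩
      + 1 * f zero + + 0                            ≡⟨ ℤP.+-identityʳ _ ⟩
      + 1 * f zero                                  ≡⟨ ℤP.*-identityˡ _ ⟩
      f zero                                        ∎
  delta-sum {suc n} (suc a) f = trans (ℤP.+-identityˡ _) (delta-sum a (f ∘ suc))

  excluded-sum : ∀ a (f : Colour → ℤ) → ∑[ x < q ] (ne a x * f x) ≡ sum f - f a
  excluded-sum a f = begin
      ∑[ x < q ] (ne a x * f x)
    ≡⟨ sum-cong-≗ (λ x → trans (cong (_* f x) (ne≡1-δ a x)) (expand (δ a x) (f x))) ⟩
      ∑[ x < q ] (+ 1 * f x + - + 1 * (δ a x * f x))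
    ≡⟨ ∑-linear (+ 1) (- + 1) f (λ x → δ a x * f x) ⟩
      + 1 * sum f + - + 1 * ∑[ x < q ] (δ a x * f x)
    ≡⟨ cong (λ s → + 1 * sum f + - + 1 * s) (delta-sum a f) ⟩
      + 1 * sum f + - + 1 * f a
    ≡⟨ collapse (sum f) (f a) ⟩
      sum f - f a
    ∎
    where
    expand : ∀ d y → (+ 1 - d) * y ≡ + 1 * y + - + 1 * (d * y)
    expand = solve-∀
    collapse : ∀ s y → + 1 * s + - + 1 * y ≡ s - y
    collapse = solve-∀

  neighbour-sum : ∀ a → ∑[ x < q ] ne a x ≡ t
  neighbour-sum a = begin
      ∑[ x < q ] ne a x             ≡⟨ sum-cong-≗ (λ x → sym (ℤP.*-identityʳ (ne a x))) ⟩
      ∑[ x < q ] (ne a x * + 1)     ≡⟨ excluded-sum a (λ _ → + 1) ⟩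
      ∑[ x < q ] (+ 1) - + 1        ≡⟨ cong (_- + 1) (sum-ones q) ⟩
      t                             ∎

  two-step-sum : ∀ a b → ∑[ x < q ] (ne a x * ne x b) ≡ t - ne a b
  two-step-sum a b = trans (excluded-sum a (λ x → ne x b))
    (cong (_- ne a b) (trans (sum-cong-≗ (λ x → ne-sym x b)) (neighbour-sum b)))

  pathWeight : ∀ {p} → Colour → Vec Colour p → Colour → ℤ
  pathWeight a [] b = ne a b
  pathWeight a (x ∷ xs) b = ne a x * pathWeight x xs b

  alternatingTerm : ∀ p → Fin p → ℤ
  alternatingTerm p i = (- + 1) ^ toℕ i * t ^ (p ∸ toℕ i)

  alternating : ℕ → ℤ
  alternating p = ∑[ i < p ] alternatingTerm p i

  alternating-suc : ∀ p → alternating (suc p) ≡ t * alternating p + (- + 1) ^ p * t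
  alternating-suc p = begin
      alternating (suc p)
    ≡⟨ sum-init-last (alternatingTerm (suc p)) ⟩
      ∑[ i < p ] alternatingTerm (suc p) (inject₁ i) + alternatingTerm (suc p) (fromℕ p)
    ≡⟨ cong₂ _+_ (trans (sum-cong-≗ initial) (sym (*-distribˡ-sum t (alternatingTerm p)))) final ⟩
      t * alternating p + (- + 1) ^ p * t
    ∎
    where
    initial : ∀ i → alternatingTerm (suc p) (inject₁ i) ≡ t * alternatingTerm p i
    initial i = begin
        (- + 1) ^ toℕ (inject₁ i) * t ^ (suc p ∸ toℕ (inject₁ i))
      ≡⟨ cong (λ e → (- + 1) ^ e * t ^ (suc p ∸ e)) (FinP.toℕ-inject₁ i) ⟩
        (- + 1) ^ toℕ i * t ^ (suc p ∸ toℕ i)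
      ≡⟨ cong (λ e → (- + 1) ^ toℕ i * t ^ e) (ℕP.+-∸-assoc 1 (ℕP.<⇒≤ (FinP.toℕ<n i))) ⟩
        (- + 1) ^ toℕ i * (t * t ^ (p ∸ toℕ i))
      ≡⟨ swap ((- + 1) ^ toℕ i) t (t ^ (p ∸ toℕ i)) ⟩
        t * alternatingTerm p i
      ∎
      where
      swap : ∀ x y z → x * (y * z) ≡ y * (x * z)
      swap = solve-∀
    final : alternatingTerm (suc p) (fromℕ p) ≡ (- + 1) ^ p * t
    final = begin
        (- + 1) ^ toℕ (fromℕ p) * t ^ (suc p ∸ toℕ (fromℕ p))
      ≡⟨ cong (λ e → (- + 1) ^ e * t ^ (suc p ∸ e)) (FinP.toℕ-fromℕ p) ⟩
        (- + 1) ^ p * t ^ (suc p ∸ p)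
      ≡⟨ cong (λ e → (- + 1) ^ p * t ^ e) (ℕP.m+n∸n≡m 1 p) ⟩
        (- + 1) ^ p * (t * + 1)
      ≡⟨ cong (_*_ ((- + 1) ^ p)) (ℤP.*-identityʳ t) ⟩
        (- + 1) ^ p * t
      ∎

  walk-count : ∀ p a b → ∑col p (λ xs → pathWeight a xs b) ≡ alternating p + (- + 1) ^ p * ne a b
  walk-count zero a b = sym (trans (ℤP.+-identityˡ _) (ℤP.*-identityˡ (ne a b)))
  walk-count (suc p) a b = begin
      ∑[ x < q ] ∑col p (λ xs → ne a x * pathWeight x xs b)
    ≡⟨ sum-cong-≗ (λ x → trans (∑col-*ˡ p (ne a x) (λ xs → pathWeight x xs b))
                                (cong (_*_ (ne a x)) (walk-count p x b))) ⟩
      ∑[ x < q ] (ne a x * (c + s * ne x b))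
    ≡⟨ sum-cong-≗ (λ x → distribute (ne a x) c s (ne x b)) ⟩
      ∑[ x < q ] (c * ne a x + s * (ne a x * ne x b))
    ≡⟨ ∑-linear c s (ne a) (λ x → ne a x * ne x b) ⟩
      c * ∑[ x < q ] ne a x + s * ∑[ x < q ] (ne a x * ne x b)
    ≡⟨ cong₂ (λ u v → c * u + s * v) (neighbour-sum a) (two-step-sum a b) ⟩
      c * t + s * (t - ne a b)
    ≡⟨ regroup t c s (ne a b) ⟩
      (t * c + s * t) + (- + 1 * s) * ne a b
    ≡⟨ cong (_+ (- + 1 * s) * ne a b) (alternating-suc p) ⟨
      alternating (suc p) + (- + 1) ^ suc p * ne a b
    ∎
    where
    c s : ℤ
    c = alternating p
    s = (- + 1) ^ p
    distribute : ∀ x c s y → x * (c + s * y) ≡ c * x + s * (x * y)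
    distribute = solve-∀
    regroup : ∀ t c s n → c * t + s * (t - n) ≡ (t * c + s * t) + (- + 1 * s) * n
    regroup = solve-∀

  positiveWeight : ∀ {V} → (Fin V → Colour) → List (Fin V × Fin V) → ℤ
  positiveWeight col = ∏ₗ (λ (x , y) → ne (col x) (col y))

  -- Edge weights depend only on the colours of the endpoints, hence are
  -- invariant under relabelling the vertices.
  positiveWeight-relabel : ∀ {V W} (h : Fin V → Fin W) (col : Fin W → Colour) (col′ : Fin V → Colour) →
    (∀ x → col (h x) ≡ col′ x) → ∀ es →
    positiveWeight col (map (λ (x , y) → (h x , h y)) es) ≡ positiveWeight col′ es
  positiveWeight-relabel h col col′ e es =
    trans (∏ₗ-map _ _ es) (∏ₗ-cong (λ (x , y) → cong₂ ne (e x) (e y)) es)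

  pathEdges : ∀ {V} d → Fin V → (Fin (suc d) → Fin V) → Fin V → List (Fin V × Fin V)
  pathEdges d u g v =
    (u , g zero) ∷ (map (λ j → (g (inject₁ j) , g (suc j))) (allFin d) ++ (g (fromℕ d) , v) ∷ [])

  pathEdges-weight : ∀ {V} d u (g : Fin (suc d) → Fin V) v (col : Fin V → Colour) →
    positiveWeight col (pathEdges d u g v) ≡ pathWeight (col u) (Vec.tabulate (col ∘ g)) (col v)
  pathEdges-weight zero u g v col = cong (_*_ (ne (col u) (col (g zero)))) (ℤP.*-identityʳ _)
  pathEdges-weight {V} (suc d) u g v col = cong (_*_ (ne (col u) (col (g zero))))
    (trans (cong (positiveWeight col) tail-is-path) (pathEdges-weight d (g zero) (g ∘ suc) v col))
    where
    step : Fin (suc d) → Fin V × Fin V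
    step j = (g (inject₁ j) , g (suc j))
    tail-is-path : step zero ∷ (map step (List.tabulate suc) ++ (g (fromℕ (suc d)) , v) ∷ [])
                   ≡ pathEdges d (g zero) (g ∘ suc) v
    tail-is-path = cong (λ es → step zero ∷ (es ++ (g (fromℕ (suc d)) , v) ∷ []))
      (trans (ListP.map-tabulate suc step) (sym (ListP.map-tabulate (λ j → j) (step ∘ suc))))

  coeffSum≡alternating : ∀ p → coeffSum (suc (suc p)) k ≡ alternating p
  coeffSum≡alternating p = sum-applyUpTo (λ i → (- + 1) ^ i * t ^ (p ∸ i)) (λ i → i) p

-- The Book graph B(m, n+1) with m = d + 3: its first page is a path with
-- p = d + 1 inner vertices, and the remaining pages form a copy of B(m, n).
module Book (k d n : ℕ) where
  open Colourings k

  m p r : ℕ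
  m = suc (suc (suc d))
  p = suc d
  r = n ℕ.* p

  weight₁ : ∀ n′ → Coloring k (BookV m n′) → ℤ
  weight₁ n′ c = ∏ₗ (edgeWeight c) (E (B1* m n′))

  embed : Fin (BookV m n) → Fin (BookV m (suc n))
  embed zero = zero
  embed (suc zero) = suc zero
  embed (suc (suc i)) = suc (suc (p ↑ʳ i))

  embedEdge : Fin (BookV m n) × Fin (BookV m n) → Fin (BookV m (suc n)) × Fin (BookV m (suc n))
  embedEdge (x , y) = (embed x , embed y)

  page-suc : ∀ l → pageEdges m (suc n) (suc l) ≡ map embedEdge (pageEdges m n l)
  page-suc l = cong (_∷_ (embedEdge (bu m n , inner m n l zero))) (sym (begin
      map embedEdge (map inside (allFin d) ++ last ∷ [])
    ≡⟨ ListP.map-++ embedEdge (map inside (allFin d)) (last ∷ []) ⟩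
      map embedEdge (map inside (allFin d)) ++ embedEdge last ∷ []
    ≡⟨ cong (_++ embedEdge last ∷ []) (sym (ListP.map-∘ (allFin d))) ⟩
      map (embedEdge ∘ inside) (allFin d) ++ embedEdge last ∷ []
    ∎))
    where
    inside : Fin d → Fin (BookV m n) × Fin (BookV m n)
    inside j = (inner m n l (inject₁ j) , inner m n l (suc j))
    last : Fin (BookV m n) × Fin (BookV m n)
    last = (inner m n l (fromℕ d) , bv m n)

  bookEdges-suc : allPageEdges m (suc n) ≡ pageEdges m (suc n) zero ++ map embedEdge (allPageEdges m n)
  bookEdges-suc = cong (pageEdges m (suc n) zero ++_) (begin
      concat (map (pageEdges m (suc n)) (List.tabulate suc))
    ≡⟨ cong concat (trans (ListP.map-tabulate suc (pageEdges m (suc n)))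
                          (sym (ListP.map-tabulate (λ l → l) (pageEdges m (suc n) ∘ suc)))) ⟩
      concatMap (pageEdges m (suc n) ∘ suc) (allFin n)
    ≡⟨ cong concat (ListP.map-cong page-suc (allFin n)) ⟩
      concatMap (map embedEdge ∘ pageEdges m n) (allFin n)
    ≡⟨ ListP.map-concatMap embedEdge (pageEdges m n) (allFin n) ⟨
      map embedEdge (allPageEdges m n)
    ∎)

  embed-colour : ∀ a b (xs : Vec Colour p) (ys : Vec Colour r) x →
    lookup (a ∷ b ∷ (xs Vec.++ ys)) (embed x) ≡ lookup (a ∷ b ∷ ys) x
  embed-colour a b xs ys zero = refl
  embed-colour a b xs ys (suc zero) = refl
  embed-colour a b xs ys (suc (suc i)) = VecP.lookup-++ʳ xs ys i

  firstPage-weight : ∀ a b (xs : Vec Colour p) (ys : Vec Colour r) →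
    positiveWeight (lookup (a ∷ b ∷ (xs Vec.++ ys))) (pageEdges m (suc n) zero) ≡ pathWeight a xs b
  firstPage-weight a b xs ys =
    trans (pathEdges-weight d (bu m (suc n)) (inner m (suc n) zero) (bv m (suc n)) (lookup c))
      (cong (λ zs → pathWeight a zs b)
        (trans (VecP.tabulate-cong (VecP.lookup-++ˡ xs ys)) (VecP.tabulate∘lookup xs)))
    where
    c : Coloring k (BookV m (suc n))
    c = a ∷ b ∷ (xs Vec.++ ys)

  weight₁-suc : ∀ a b (xs : Vec Colour p) (ys : Vec Colour r) →
    weight₁ (suc n) (a ∷ b ∷ (xs Vec.++ ys)) ≡ pathWeight a xs b * weight₁ n (a ∷ b ∷ ys)
  weight₁-suc a b xs ys = begin
      N * ∏ₗ (edgeWeight c) (map positive (allPageEdges m (suc n)))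
    ≡⟨ cong (_*_ N) (∏ₗ-map (edgeWeight c) positive (allPageEdges m (suc n))) ⟩
      N * positiveWeight (lookup c) (allPageEdges m (suc n))
    ≡⟨ cong (λ es → N * positiveWeight (lookup c) es) bookEdges-suc ⟩
      N * positiveWeight (lookup c) (pageEdges m (suc n) zero ++ map embedEdge (allPageEdges m n))
    ≡⟨ cong (_*_ N) (∏ₗ-++ (λ (x , y) → ne (lookup c x) (lookup c y)) (pageEdges m (suc n) zero) (map embedEdge (allPageEdges m n))) ⟩
      N * (positiveWeight (lookup c) (pageEdges m (suc n) zero)
           * positiveWeight (lookup c) (map embedEdge (allPageEdges m n)))
    ≡⟨ cong₂ (λ u w → N * (u * w)) (firstPage-weight a b xs ys)
         (positiveWeight-relabel embed (lookup c) (lookup c′) (embed-colour a b xs ys) (allPageEdges m n)) ⟩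
      N * (pathWeight a xs b * positiveWeight (lookup c′) (allPageEdges m n))
    ≡⟨ swap N (pathWeight a xs b) _ ⟩
      pathWeight a xs b * (N * positiveWeight (lookup c′) (allPageEdges m n))
    ≡⟨ cong (λ w → pathWeight a xs b * (N * w)) (∏ₗ-map (edgeWeight c′) positive (allPageEdges m n)) ⟨
      pathWeight a xs b * weight₁ n c′
    ∎
    where
    c : Coloring k (BookV m (suc n))
    c = a ∷ b ∷ (xs Vec.++ ys)
    c′ : Coloring k (BookV m n)
    c′ = a ∷ b ∷ ys
    N : ℤ
    N = compatible neg a b
    swap : ∀ x y z → x * (y * z) ≡ y * (x * z)
    swap = solve-∀

  rest : Colour → Colour → ℤ
  rest a b = ∑col r (λ ys → weight₁ n (a ∷ b ∷ ys))

  fibre-sum : ∀ a b →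
    ∑col (p ℕ.+ r) (λ zs → weight₁ (suc n) (a ∷ b ∷ zs))
      ≡ alternating p * rest a b + (- + 1) ^ p * (ne a b * rest a b)
  fibre-sum a b = begin
      ∑col (p ℕ.+ r) (λ zs → weight₁ (suc n) (a ∷ b ∷ zs))
    ≡⟨ ∑col-++ p r (λ zs → weight₁ (suc n) (a ∷ b ∷ zs)) ⟩
      ∑col p (λ xs → ∑col r (λ ys → weight₁ (suc n) (a ∷ b ∷ (xs Vec.++ ys))))
    ≡⟨ ∑col-cong p (λ xs → trans (∑col-cong r (weight₁-suc a b xs))
                                  (∑col-*ˡ r (pathWeight a xs b) (λ ys → weight₁ n (a ∷ b ∷ ys)))) ⟩
      ∑col p (λ xs → pathWeight a xs b * rest a b)
    ≡⟨ ∑col-*ʳ p (rest a b) (λ xs → pathWeight a xs b) ⟩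
      ∑col p (λ xs → pathWeight a xs b) * rest a b
    ≡⟨ cong (_* rest a b) (walk-count p a b) ⟩
      (alternating p + (- + 1) ^ p * ne a b) * rest a b
    ≡⟨ distribute (alternating p) ((- + 1) ^ p) (ne a b) (rest a b) ⟩
      alternating p * rest a b + (- + 1) ^ p * (ne a b * rest a b)
    ∎
    where
    distribute : ∀ c s e x → (c + s * e) * x ≡ c * x + s * (e * x)
    distribute = solve-∀

  -- B_m^n differs from B₁*(m,n) only by the positive edge uv.
  χ-Bmn : + χ (Bmn m n) k ≡ ∑[ a < q ] ∑[ b < q ] (ne a b * rest a b)
  χ-Bmn = trans (χ-as-sum (Bmn m n))
    (sum-cong-≗ (λ a → sum-cong-≗ (λ b → ∑col-*ˡ r (ne a b) (λ ys → weight₁ n (a ∷ b ∷ ys)))))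

  recurrence : + χ (B1* m (suc n)) k
    ≡ coeffSum m k * + χ (B1* m n) k + ((- + 1) ^ (m ∸ 2)) * + χ (Bmn m n) k
  recurrence = begin
      + χ (B1* m (suc n)) k
    ≡⟨ χ-as-sum (B1* m (suc n)) ⟩
      ∑[ a < q ] ∑[ b < q ] ∑col (p ℕ.+ r) (λ zs → weight₁ (suc n) (a ∷ b ∷ zs))
    ≡⟨ sum-cong-≗ (λ a → trans (sum-cong-≗ (fibre-sum a)) (∑-linear c s (rest a) (λ b → ne a b * rest a b))) ⟩
      ∑[ a < q ] (c * ∑[ b < q ] rest a b + s * ∑[ b < q ] (ne a b * rest a b))
    ≡⟨ ∑-linear c s (λ a → ∑[ b < q ] rest a b) (λ a → ∑[ b < q ] (ne a b * rest a b)) ⟩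
      c * ∑[ a < q ] ∑[ b < q ] rest a b + s * ∑[ a < q ] ∑[ b < q ] (ne a b * rest a b)
    ≡⟨ cong₂ _+_ (cong₂ _*_ (coeffSum≡alternating p) (χ-as-sum (B1* m n))) (cong (_*_ s) χ-Bmn) ⟨
      coeffSum m k * + χ (B1* m n) k + s * + χ (Bmn m n) k
    ∎
    where
    c s : ℤ
    c = alternating p
    s = (- + 1) ^ p

theorem6p8 : (m n : ℕ) → 3 ≤ m → 2 ≤ n → (k : ℕ) → 1 ≤ k →
    + χ (B1* m n) k
      ≡ coeffSum m k * + χ (B1* m (n ∸ 1)) k
        + ((- + 1) ^ (m ∸ 2)) * + χ (Bmn m (n ∸ 1)) k
theorem6p8 (suc (suc (suc d))) (suc n) (s≤s (s≤s (s≤s _))) (s≤s (s≤s _)) k _ = Book.recurrence k d n
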